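{- For any $\epsilon>0$ there exist graphs $G=(V,E)$ (of arbitrarily large treewidth $t=tw(G)$) with a coloring $c:V\to\{\mathbf{r},\mathbf{b}\}$ and a collection $\mathcal{H}$ of connected induced subgraphs of $G$ such that $(G,\mathcal{H})$ is non-piercing and any primal support $Q$ on $\mathbf{b}(V)$ of $(G,\mathcal{H})$ has treewidth $\Omega(2^{t/(8(1+\epsilon))})$.
   Context: $(G,\mathcal{H})$ is non-piercing if each $H\in\mathcal{H}$ is connected and for any $H,H'\in\mathcal{H}$, the subgraph of $H$ induced by the vertices of $H$ not in $H'$ is connected. $\mathbf{b}(V)=c^{ -1}(\mathbf{b})$ and $\mathbf{b}(H)=V(H)\cap\mathbf{b}(V)$. A primal support is a graph $Q$ on $\mathbf{b}(V)$ such that $Q[\mathbf{b}(H)]$ is connected for every $H\in\mathcal{H}$.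
   Formalization: The parameter ε ranges only over the positive rationals. -}

module Defs where

open import Data.Nat using (ℕ; zero; suc; _≤_)
open import Data.Fin using (Fin; zero; suc; toℕ; _≟_)
open import Data.Fin.Subset using (Subset; _∈_; ∣_∣; _∩_; _─_; Nonempty)
open import Data.Bool using (Bool; true; false; _∨_)
open import Data.Vec using (tabulate; lookup)
open import Data.Product using (Σ; ∃; ∃-syntax; _×_; _,_)
open import Relation.Nullary.Decidable using (⌊_⌋)
open import Relation.Binary.PropositionalEquality using (_≡_)

record Graph (n : ℕ) : Set where
  field
    adj        : Fin n → Fin n → Bool
    adj-sym    : ∀ u v → adj u v ≡ adj v u
    adj-irrefl : ∀ u → adj u u ≡ false
open Graph public

data Walk {k : ℕ} (A : Fin k → Fin k → Bool) (S : Subset k) : Fin k → Fin k → Set where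
  stop : ∀ {u} → u ∈ S → Walk A S u u
  step : ∀ {u w v} → u ∈ S → A u w ≡ true → Walk A S w v → Walk A S u v

Connected : ∀ {k} → (Fin k → Fin k → Bool) → Subset k → Set
Connected A S = ∀ u v → u ∈ S → v ∈ S → Walk A S u v

-- A tree on node set Fin (suc m), encoded by a parent array:
-- node (suc i) has parent (parent i), whose index is ≤ i (so < suc i).
-- Every finite nonempty tree is (up to relabelling) of this form.
record RootedTree (m : ℕ) : Set where
  field
    parent    : Fin m → Fin (suc m)
    parent-lt : ∀ i → toℕ (parent i) ≤ toℕ i
open RootedTree public

isParentOf : ∀ {m} → RootedTree m → Fin (suc m) → Fin (suc m) → Bool
isParentOf T p zero    = false
isParentOf T p (suc i) = ⌊ parent T i ≟ p ⌋

treeAdj : ∀ {m} → RootedTree m → Fin (suc m) → Fin (suc m) → Bool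
treeAdj T x y = isParentOf T x y ∨ isParentOf T y x

record TreeDecomposition {n : ℕ} (G : Graph n) (k : ℕ) : Set where
  field
    m        : ℕ
    tree     : RootedTree m
    bag      : Fin (suc m) → Subset n
    bag-size : ∀ x → ∣ bag x ∣ ≤ suc k
    cover-v  : ∀ v → ∃[ x ] (v ∈ bag x)
    cover-e  : ∀ u v → adj G u v ≡ true → ∃[ x ] (u ∈ bag x × v ∈ bag x)
    coherent : ∀ v → Connected (treeAdj tree) (tabulate (λ x → lookup (bag x) v))

Treewidth : ∀ {n} → Graph n → ℕ → Set
Treewidth G t = TreeDecomposition G t × (∀ k → TreeDecomposition G k → t ≤ k)

data Colour : Set where
  red blue : Colour

isBlue : Colour → Bool
isBlue red  = false
isBlue blue = true

blueSet : ∀ {n} → (Fin n → Colour) → Subset n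
blueSet c = tabulate (λ v → isBlue (c v))

NonPiercing : ∀ {n h} → Graph n → (Fin h → Subset n) → Set
NonPiercing G H =
  (∀ i → Nonempty (H i) × Connected (adj G) (H i)) ×
  (∀ i j → Connected (adj G) (H i ─ H j))

-- Q is a primal support on b(V): Q only has edges between blue vertices
-- (red vertices are isolated, i.e. Q is a graph on b(V)), and Q[b(H)] is connected.
PrimalSupport : ∀ {n h} → Graph n → (Fin n → Colour) → (Fin h → Subset n) → Graph n → Set
PrimalSupport G c H Q =
  (∀ u v → adj Q u v ≡ true → u ∈ blueSet c × v ∈ blueSet c) ×
  (∀ i → Connected (adj Q) (H i ∩ blueSet c))

-- G consists of 4r red vertices, adjacent to everything, and 2^r pairwise non-adjacent blue
-- vertices, so tw(G) = 4r.  Blue vertices are labelled by the subsets c(u) of an r-set, and the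
-- hyperedge of a blue pair (u, v) is {u, v} together with red vertices recording c(u), ∁c(u),
-- c(v), ∁c(v).  Sets of the form c ++ ∁c form an antichain, so two distinct hyperedges differ
-- in a red vertex, and any vertex set containing a red vertex is connected: the family is
-- non-piercing.  The blue part of the hyperedge of (u, v) is exactly {u, v}, so every primal
-- support contains all blue pairs, i.e. a clique on 2^r vertices; since a clique lies in one
-- bag of any tree decomposition, the support has treewidth at least 2^r − 1.
module Submission where

open import Defs
open import Data.Nat using (ℕ; zero; suc; _≤_; _*_; _+_; _^_; z≤n; s≤s)
open import Data.Nat.Properties using (≤-refl; ≤-trans; ≤-antisym; ≤-reflexive; ≤-pred; <⇒≱; n≤1+n; m≤m+n; +-comm; +-suc; +-identityʳ; *-identityˡ; +-monoʳ-≤; *-monoʳ-≤; *-monoˡ-≤; ^-zeroˡ; ^-monoʳ-≤; ^-monoˡ-≤; ^-*-assoc; ≤-totalOrder; module ≤-Reasoning)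
open import Data.Nat.Tactic.RingSolver using (solve-∀)
open import Data.Fin using (Fin; zero; suc; toℕ; _↑ˡ_; _↑ʳ_; splitAt; combine; remQuot; _≟_)
open import Data.Fin.Properties using (toℕ-injective; splitAt⁻¹-↑ˡ; splitAt⁻¹-↑ʳ; remQuot-combine; any?)
open import Data.Fin.Subset using (Subset; _∈_; _∉_; ∣_∣; _∩_; _∪_; _─_; ∁; ⊤; ⊥; ⁅_⁆; _⊆_; Nonempty; inside; outside)
open import Data.Fin.Subset.Properties
open import Data.Bool using (Bool; true; false; if_then_else_)
open import Data.Vec using ([]; _∷_; _++_; tabulate; lookup; here; there)
open import Data.Vec.Properties using (∷-injectiveˡ; ∷-injectiveʳ; []=⇒lookup; lookup⇒[]=; lookup∘tabulate; tabulate∘lookup; tabulate-cong)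
open import Data.List using (List; filter; allFin)
import Data.List.Relation.Unary.All as All
open import Data.List.Relation.Unary.All.Properties using (all-filter)
open import Data.List.Membership.Propositional.Properties using (∈-filter⁺; ∈-allFin)
open import Data.List.Extrema ≤-totalOrder using (argmax; argmax-all; f[xs]≤f[argmax])
open import Data.Product using (Σ; ∃-syntax; _×_; _,_; proj₁; proj₂; uncurry)
open import Data.Sum using (_⊎_; inj₁; inj₂; [_,_])
open import Function using (_∘_; mk⇔)
open import Relation.Nullary using (¬_; Dec; yes; no; does; contradiction; ¬?; _×-dec_; _⊎-dec_)
open import Relation.Nullary.Decidable using (dec-true; dec-false; does-⇔; decidable-stable)
open import Relation.Binary.PropositionalEquality hiding ([_])

private
  variable
    m n : ℕ

witness : {A : Set} (a? : Dec A) → does a? ≡ true → A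
witness (yes a) _ = a
witness (no _) ()

data SplitView (m : ℕ) {n : ℕ} : Fin (m + n) → Set where
  left  : (i : Fin m) → SplitView m (i ↑ˡ n)
  right : (j : Fin n) → SplitView m (m ↑ʳ j)

splitView : ∀ m {n} (x : Fin (m + n)) → SplitView m x
splitView zero    x       = right x
splitView (suc m) zero    = left zero
splitView (suc m) (suc x) with splitView m x
... | left i  = left (suc i)
... | right j = right j

∈-++⁺ˡ : {p : Subset m} {q : Subset n} {i : Fin m} → i ∈ p → i ↑ˡ n ∈ p ++ q
∈-++⁺ˡ here        = here
∈-++⁺ˡ (there i∈p) = there (∈-++⁺ˡ i∈p)

∈-++⁺ʳ : (p : Subset m) {q : Subset n} {j : Fin n} → j ∈ q → m ↑ʳ j ∈ p ++ q
∈-++⁺ʳ []      j∈q = j∈q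
∈-++⁺ʳ (_ ∷ p) j∈q = there (∈-++⁺ʳ p j∈q)

∈-++⁻ˡ : (p : Subset m) {q : Subset n} {i : Fin m} → i ↑ˡ n ∈ p ++ q → i ∈ p
∈-++⁻ˡ (_ ∷ p) {i = zero}  here       = here
∈-++⁻ˡ (_ ∷ p) {i = suc i} (there i∈) = there (∈-++⁻ˡ p i∈)

∈-++⁻ʳ : (p : Subset m) {q : Subset n} {j : Fin n} → m ↑ʳ j ∈ p ++ q → j ∈ q
∈-++⁻ʳ []      j∈q        = j∈q
∈-++⁻ʳ (_ ∷ p) (there j∈) = ∈-++⁻ʳ p j∈

++-⊆⁻ : (p p′ : Subset m) {q q′ : Subset n} → p ++ q ⊆ p′ ++ q′ → p ⊆ p′ × q ⊆ q′
++-⊆⁻ p p′ sub = ∈-++⁻ˡ p′ ∘ sub ∘ ∈-++⁺ˡ , ∈-++⁻ʳ p′ ∘ sub ∘ ∈-++⁺ʳ p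

∣p++q∣≡∣p∣+∣q∣ : (p : Subset m) (q : Subset n) → ∣ p ++ q ∣ ≡ ∣ p ∣ + ∣ q ∣
∣p++q∣≡∣p∣+∣q∣ []            q = refl
∣p++q∣≡∣p∣+∣q∣ (inside  ∷ p) q = cong suc (∣p++q∣≡∣p∣+∣q∣ p q)
∣p++q∣≡∣p∣+∣q∣ (outside ∷ p) q = ∣p++q∣≡∣p∣+∣q∣ p q

∣p∪q∣≤∣p∣+∣q∣ : (p q : Subset n) → ∣ p ∪ q ∣ ≤ ∣ p ∣ + ∣ q ∣
∣p∪q∣≤∣p∣+∣q∣ []            []            = z≤n
∣p∪q∣≤∣p∣+∣q∣ (inside  ∷ p) (x ∷ q)       = s≤s (≤-trans (∣p∪q∣≤∣p∣+∣q∣ p q) (+-monoʳ-≤ ∣ p ∣ (∣p∣≤∣x∷p∣ x q)))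
∣p∪q∣≤∣p∣+∣q∣ (outside ∷ p) (inside  ∷ q) = ≤-trans (s≤s (∣p∪q∣≤∣p∣+∣q∣ p q)) (≤-reflexive (sym (+-suc ∣ p ∣ ∣ q ∣)))
∣p∪q∣≤∣p∣+∣q∣ (outside ∷ p) (outside ∷ q) = ∣p∪q∣≤∣p∣+∣q∣ p q

x∈p─q⇒x∉q : (p q : Subset n) {x : Fin n} → x ∈ p ─ q → x ∉ q
x∈p─q⇒x∉q (inside  ∷ p) (outside ∷ q) here       = λ ()
x∈p─q⇒x∉q (outside ∷ p) (outside ∷ q) {zero} ()
x∈p─q⇒x∉q (_       ∷ p) (inside  ∷ q) {zero} ()
x∈p─q⇒x∉q (_       ∷ p) (_       ∷ q) (there x∈) = x∈p─q⇒x∉q p q x∈ ∘ drop-there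

⊆-or-escapes : (p q : Subset n) → p ⊆ q ⊎ ∃[ x ] (x ∈ p × x ∉ q)
⊆-or-escapes p q with any? (λ x → x ∈? p ×-dec ¬? (x ∈? q))
... | yes escape = inj₂ escape
... | no  none   = inj₁ λ {x} x∈p → decidable-stable (x ∈? q) (λ x∉q → none (x , x∈p , x∉q))

++∁-⊆⇒≡ : (p q : Subset n) → p ++ ∁ p ⊆ q ++ ∁ q → p ≡ q
++∁-⊆⇒≡ p q sub with ++-⊆⁻ p q sub
... | p⊆q , ∁p⊆∁q = ⊆-antisym p⊆q q⊆p
  where
  q⊆p : q ⊆ p
  q⊆p {x} x∈q = decidable-stable (x ∈? p) (λ x∉p → x∈∁p⇒x∉p (∁p⊆∁q (x∉p⇒x∈∁p x∉p)) x∈q)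

++∁-nonempty : (p : Subset (suc n)) → Nonempty (p ++ ∁ p)
++∁-nonempty {n} p with zero ∈? p
... | yes 0∈p = zero ↑ˡ suc n , ∈-++⁺ˡ 0∈p
... | no  0∉p = suc n ↑ʳ zero , ∈-++⁺ʳ p (x∉p⇒x∈∁p 0∉p)

∈-tabulate⁺ : (f : Fin n → Bool) {x : Fin n} → f x ≡ true → x ∈ tabulate f
∈-tabulate⁺ f {x} fx = lookup⇒[]= x (tabulate f) (trans (lookup∘tabulate f x) fx)

∈-tabulate⁻ : (f : Fin n → Bool) {x : Fin n} → x ∈ tabulate f → f x ≡ true
∈-tabulate⁻ f {x} x∈ = trans (sym (lookup∘tabulate f x)) ([]=⇒lookup x∈)

IsClique : Graph n → Subset n → Set
IsClique G K = ∀ {u v} → u ∈ K → v ∈ K → u ≢ v → adj G u v ≡ true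

subsingleton⇒connected : ∀ {A : Fin n → Fin n → Bool} {S : Subset n} (c : Fin n) →
                         (∀ {x} → x ∈ S → x ≡ c) → Connected A S
subsingleton⇒connected c only u v u∈S v∈S =
  subst (Walk _ _ u) (trans (only u∈S) (sym (only v∈S))) (stop u∈S)

walk-head : ∀ {A : Fin n → Fin n → Bool} {S : Subset n} {u v} → Walk A S u v → u ∈ S
walk-head (stop u∈S)     = u∈S
walk-head (step u∈S _ _) = u∈S

walk-within-pair⇒adj : (Q : Graph n) {S : Subset n} {a b : Fin n} → a ≢ b →
                       (∀ {w} → w ∈ S → w ≡ a ⊎ w ≡ b) → Walk (adj Q) S a b → adj Q a b ≡ true
walk-within-pair⇒adj Q a≢b pair (stop _) = contradiction refl a≢b
walk-within-pair⇒adj Q {a = a} a≢b pair (step _ e rest) with pair (walk-head rest)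
... | inj₂ refl = e
... | inj₁ refl = contradiction (trans (sym e) (adj-irrefl Q a)) λ ()

star : (m : ℕ) → RootedTree m
star m = record { parent = λ _ → zero ; parent-lt = λ _ → z≤n }

star-connected : {S : Subset (suc m)} → zero ∈ S → Connected (treeAdj (star m)) S
star-connected {S = S} 0∈S x y x∈S y∈S = from x x∈S (to y y∈S)
  where
  to : ∀ y → y ∈ S → Walk (treeAdj (star _)) S zero y
  to zero    _   = stop 0∈S
  to (suc _) y∈S = step 0∈S refl (stop y∈S)
  from : ∀ x → x ∈ S → Walk (treeAdj (star _)) S zero y → Walk (treeAdj (star _)) S x y
  from zero    _   w = w
  from (suc _) x∈S w = step x∈S refl w

module Ancestry {m : ℕ} (T : RootedTree m) where

  Node : Set
  Node = Fin (suc m)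

  infix 4 _≼_
  data _≼_ (a : Node) : Node → Set where
    ≼-refl  : a ≼ a
    ≼-child : ∀ {i} → a ≼ parent T i → a ≼ suc i

  ≼⇒≤ : ∀ {a z} → a ≼ z → toℕ a ≤ toℕ z
  ≼⇒≤ ≼-refl          = ≤-refl
  ≼⇒≤ (≼-child {i} d) = ≤-trans (≼⇒≤ d) (≤-trans (parent-lt T i) (n≤1+n (toℕ i)))

  parent-induction : (P : Node → Set) → P zero → (∀ i → P (parent T i) → P (suc i)) → ∀ x → P x
  parent-induction P P0 Pstep x = go (toℕ x) x ≤-refl
    where
    go : ∀ k x → toℕ x ≤ k → P x
    go _       zero    _         = P0
    go (suc k) (suc i) (s≤s i≤k) = Pstep i (go k (parent T i) (≤-trans (parent-lt T i) i≤k))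

  ≼-linear : ∀ {a b y} → a ≼ y → b ≼ y → toℕ a ≤ toℕ b → a ≼ b
  ≼-linear ≼-refl       b≼a  a≤b = subst (_ ≼_) (toℕ-injective (≤-antisym a≤b (≼⇒≤ b≼a))) ≼-refl
  ≼-linear (≼-child a≼) ≼-refl _ = ≼-child a≼
  ≼-linear (≼-child a≼) (≼-child b≼) a≤b = ≼-linear a≼ b≼ a≤b

  isParentOf-true : ∀ p y → isParentOf T p y ≡ true → ∃[ j ] (y ≡ suc j × parent T j ≡ p)
  isParentOf-true p (suc j) e with parent T j ≟ p
  ... | yes pj≡p = j , refl , pj≡p
  isParentOf-true p (suc j) () | no _

  treeAdj-true : ∀ x y → treeAdj T x y ≡ true →
                 ∃[ j ] (y ≡ suc j × parent T j ≡ x) ⊎ ∃[ j ] (x ≡ suc j × parent T j ≡ y)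
  treeAdj-true x y e with isParentOf T x y in exy
  ... | true  = inj₁ (isParentOf-true x y exy)
  ... | false = inj₂ (isParentOf-true y x e)

  Top : Subset (suc m) → Set
  Top S = ∃[ t ] (t ∈ S × ∀ {z} → z ∈ S → t ≼ z)

  module _ {S : Subset (suc m)} where

    step-below : ∀ {i u w} → parent T i ∉ S → suc i ≼ u → treeAdj T u w ≡ true → w ∈ S → suc i ≼ w
    step-below {u = u} {w} p∉S below e w∈S with treeAdj-true u w e
    ... | inj₁ (j , refl , pj≡u) = ≼-child (subst (_ ≼_) (sym pj≡u) below)
    step-below p∉S ≼-refl          e w∈S | inj₂ (j , refl , pj≡w) = contradiction (subst (_∈ S) (sym pj≡w) w∈S) p∉S
    step-below p∉S (≼-child below) e w∈S | inj₂ (j , refl , pj≡w) = subst (_ ≼_) pj≡w below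

    walk-stays-below : ∀ {i u z} → parent T i ∉ S → suc i ≼ u → Walk (treeAdj T) S u z → suc i ≼ z
    walk-stays-below p∉S below (stop _)          = below
    walk-stays-below p∉S below (step _ e rest) =
      walk-stays-below p∉S (step-below p∉S below e (walk-head rest)) rest

    module _ (S-connected : Connected (treeAdj T) S) where

      parent-∈ : ∀ {i z} → suc i ∈ S → z ∈ S → ¬ suc i ≼ z → parent T i ∈ S
      parent-∈ {i} {z} i∈S z∈S i⋠z =
        decidable-stable (parent T i ∈? S) (λ p∉S → i⋠z (walk-stays-below p∉S ≼-refl (S-connected _ _ i∈S z∈S)))

      top : ∀ {x} → x ∈ S → Top S
      top {x} = parent-induction (λ x → x ∈ S → Top S) root-top climb x
        where
        root-top : zero ∈ S → Top S
        root-top 0∈S = zero , 0∈S , λ {z} _ → parent-induction (zero ≼_) ≼-refl (λ _ → ≼-child) z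
        climb : ∀ i → (parent T i ∈ S → Top S) → suc i ∈ S → Top S
        climb i above i∈S with parent T i ∈? S
        ... | yes p∈S = above p∈S
        ... | no  p∉S = suc i , i∈S , λ z∈S → walk-stays-below p∉S ≼-refl (S-connected _ _ i∈S z∈S)

      ≼-convex : ∀ {t a y} → t ∈ S → y ∈ S → t ≼ a → a ≼ y → a ∈ S
      ≼-convex t∈S y∈S t≼a ≼-refl = y∈S
      ≼-convex {t} t∈S y∈S t≼a (≼-child {i} a≼p) =
        ≼-convex t∈S (parent-∈ y∈S t∈S i⋠t) t≼a a≼p
        where
        i⋠t : ¬ suc i ≼ t
        i⋠t i≼t = <⇒≱ (s≤s (parent-lt T i)) (≤-trans (≼⇒≤ i≼t) (≤-trans (≼⇒≤ t≼a) (≼⇒≤ a≼p)))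

argmax-∈ : (K : Subset n) (f : Fin n → ℕ) {x : Fin n} → x ∈ K → ∃[ v ] (v ∈ K × ∀ {w} → w ∈ K → f w ≤ f v)
argmax-∈ {n} K f {x} x∈K =
  argmax f x members ,
  argmax-all f x∈K (all-filter (_∈? K) (allFin n)) ,
  λ {w} w∈K → All.lookup (f[xs]≤f[argmax] x members) (∈-filter⁺ (_∈? K) (∈-allFin w) w∈K)
  where
  members : List (Fin n)
  members = filter (_∈? K) (allFin n)

occurrences : {a : ℕ} → (Fin a → Subset n) → Fin n → Subset a
occurrences bag v = tabulate (λ x → lookup (bag x) v)

∈-occurrences⁺ : {a : ℕ} (bag : Fin a → Subset n) {v : Fin n} {x : Fin a} → v ∈ bag x → x ∈ occurrences bag v
∈-occurrences⁺ bag v∈ = ∈-tabulate⁺ _ ([]=⇒lookup v∈)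

∈-occurrences⁻ : {a : ℕ} (bag : Fin a → Subset n) {v : Fin n} {x : Fin a} → x ∈ occurrences bag v → v ∈ bag x
∈-occurrences⁻ bag {v} {x} x∈ = lookup⇒[]= v (bag x) (∈-tabulate⁻ _ x∈)

module _ {G : Graph n} {k : ℕ} (D : TreeDecomposition G k) where
  open TreeDecomposition D
  open Ancestry tree

  topOf : ∀ v → Top (occurrences bag v)
  topOf v = top (coherent v) (∈-occurrences⁺ bag (proj₂ (cover-v v)))

  highest : Fin n → Node
  highest v = proj₁ (topOf v)

  ∈-highest : ∀ v → v ∈ bag (highest v)
  ∈-highest v = ∈-occurrences⁻ bag (proj₁ (proj₂ (topOf v)))

  highest-≼ : ∀ {v y} → v ∈ bag y → highest v ≼ y
  highest-≼ {v} v∈ = proj₂ (proj₂ (topOf v)) (∈-occurrences⁺ bag v∈)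

  -- The subtree of bags containing w runs from highest w down to a bag shared with v,
  -- and since highest v is an ancestor of that bag no higher than highest w, it lies on this path.
  deepest-highest-bag : {K : Subset n} {v : Fin n} → IsClique G K → v ∈ K →
                        (∀ {w} → w ∈ K → toℕ (highest w) ≤ toℕ (highest v)) → K ⊆ bag (highest v)
  deepest-highest-bag {v = v} K-clique v∈K deepest {w} w∈K with w ≟ v
  ... | yes refl = ∈-highest v
  ... | no  w≢v  with cover-e w v (K-clique w∈K v∈K w≢v)
  ...   | y , w∈y , v∈y =
    ∈-occurrences⁻ bag (≼-convex (coherent w) (∈-occurrences⁺ bag (∈-highest w)) (∈-occurrences⁺ bag w∈y)
      (≼-linear (highest-≼ w∈y) (highest-≼ v∈y) (deepest w∈K)) (highest-≼ v∈y))

  clique⊆bag : {K : Subset n} → IsClique G K → ∃[ x ] (K ⊆ bag x)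
  clique⊆bag {K} K-clique with nonempty? K
  ... | no  K-empty = zero , λ w∈K → contradiction (_ , w∈K) K-empty
  ... | yes (_ , v₀∈K) = from-deepest (argmax-∈ K (toℕ ∘ highest) v₀∈K)
    where
    from-deepest : ∃[ v ] (v ∈ K × ∀ {w} → w ∈ K → toℕ (highest w) ≤ toℕ (highest v)) → ∃[ x ] (K ⊆ bag x)
    from-deepest (v , v∈K , deepest) = highest v , deepest-highest-bag K-clique v∈K deepest

  clique-size : {K : Subset n} → IsClique G K → ∣ K ∣ ≤ suc k
  clique-size K-clique with clique⊆bag K-clique
  ... | x , K⊆bag = ≤-trans (p⊆q⇒∣p∣≤∣q∣ K⊆bag) (bag-size x)

module CompleteSplit (K : Subset n) where

  SplitEdge : Fin n → Fin n → Set
  SplitEdge u v = (u ∈ K ⊎ v ∈ K) × u ≢ v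

  splitEdge? : ∀ u v → Dec (SplitEdge u v)
  splitEdge? u v = ((u ∈? K) ⊎-dec (v ∈? K)) ×-dec ¬? (u ≟ v)

  graph : Graph n
  graph = record
    { adj        = λ u v → does (splitEdge? u v)
    ; adj-sym    = λ u v → does-⇔ (mk⇔ swap-edge swap-edge) (splitEdge? u v) (splitEdge? v u)
    ; adj-irrefl = λ u → dec-false (splitEdge? u u) (λ (_ , u≢u) → u≢u refl)
    }
    where
    swap-edge : ∀ {u v} → SplitEdge u v → SplitEdge v u
    swap-edge (inj₁ u∈K , u≢v) = inj₂ u∈K , u≢v ∘ sym
    swap-edge (inj₂ v∈K , u≢v) = inj₁ v∈K , u≢v ∘ sym

  adj⁺ : ∀ {u v} → u ∈ K ⊎ v ∈ K → u ≢ v → adj graph u v ≡ true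
  adj⁺ {u} {v} one∈K u≢v = dec-true (splitEdge? u v) (one∈K , u≢v)

  adj⁻ : ∀ {u v} → adj graph u v ≡ true → u ∈ K ⊎ v ∈ K
  adj⁻ {u} {v} e = proj₁ (witness (splitEdge? u v) e)

  meets-K⇒connected : ∀ {S c} → c ∈ K → c ∈ S → Connected (adj graph) S
  meets-K⇒connected {S} {c} c∈K c∈S u v u∈S v∈S = from u u∈S (to v v∈S)
    where
    to : ∀ v → v ∈ S → Walk (adj graph) S c v
    to v v∈S with c ≟ v
    ... | yes refl = stop c∈S
    ... | no  c≢v  = step c∈S (adj⁺ (inj₁ c∈K) c≢v) (stop v∈S)
    from : ∀ u → u ∈ S → Walk (adj graph) S c v → Walk (adj graph) S u v
    from u u∈S walk with u ≟ c
    ... | yes refl = walk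
    ... | no  u≢c  = step u∈S (adj⁺ (inj₂ c∈K) u≢c) walk

  decomposition : TreeDecomposition graph ∣ K ∣
  decomposition = record
    { m        = n
    ; tree     = star n
    ; bag      = bag
    ; bag-size = bag-size
    ; cover-v  = λ v → suc v , q⊆p∪q K ⁅ v ⁆ (x∈⁅x⁆ v)
    ; cover-e  = cover-e
    ; coherent = coherent
    }
    where
    bag : Fin (suc n) → Subset n
    bag zero    = K
    bag (suc v) = K ∪ ⁅ v ⁆
    bag-size : ∀ x → ∣ bag x ∣ ≤ suc ∣ K ∣
    bag-size zero    = n≤1+n ∣ K ∣
    bag-size (suc v) = begin
      ∣ K ∪ ⁅ v ⁆ ∣     ≤⟨ ∣p∪q∣≤∣p∣+∣q∣ K ⁅ v ⁆ ⟩
      ∣ K ∣ + ∣ ⁅ v ⁆ ∣ ≡⟨ cong (∣ K ∣ +_) (∣⁅x⁆∣≡1 v) ⟩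
      ∣ K ∣ + 1         ≡⟨ +-comm ∣ K ∣ 1 ⟩
      suc ∣ K ∣         ∎
      where open ≤-Reasoning
    cover-e : ∀ u v → adj graph u v ≡ true → ∃[ x ] (u ∈ bag x × v ∈ bag x)
    cover-e u v e with adj⁻ e
    ... | inj₁ u∈K = suc v , p⊆p∪q ⁅ v ⁆ u∈K , q⊆p∪q K ⁅ v ⁆ (x∈⁅x⁆ v)
    ... | inj₂ v∈K = suc u , q⊆p∪q K ⁅ u ⁆ (x∈⁅x⁆ u) , p⊆p∪q ⁅ u ⁆ v∈K
    coherent : ∀ v → Connected (treeAdj (star n)) (occurrences bag v)
    coherent v with v ∈? K
    ... | yes v∈K = star-connected (∈-occurrences⁺ bag v∈K)
    ... | no  v∉K = subsingleton⇒connected (suc v) only-leaf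
      where
      only-leaf : ∀ {x} → x ∈ occurrences bag v → x ≡ suc v
      only-leaf {zero}  x∈ = contradiction (∈-occurrences⁻ bag x∈) v∉K
      only-leaf {suc w} x∈ with x∈p∪q⁻ K ⁅ w ⁆ (∈-occurrences⁻ bag x∈)
      ... | inj₁ v∈K = contradiction v∈K v∉K
      ... | inj₂ v∈w = cong suc (sym (x∈⁅y⁆⇒x≡y w v∈w))

  extended-clique : ∀ b → IsClique graph (K ∪ ⁅ b ⁆)
  extended-clique b {u} {v} u∈ v∈ u≢v with x∈p∪q⁻ K ⁅ b ⁆ u∈ | x∈p∪q⁻ K ⁅ b ⁆ v∈
  ... | inj₁ u∈K | _        = adj⁺ (inj₁ u∈K) u≢v
  ... | inj₂ _   | inj₁ v∈K = adj⁺ (inj₂ v∈K) u≢v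
  ... | inj₂ u≡b | inj₂ v≡b = contradiction (trans (x∈⁅y⁆⇒x≡y b u≡b) (sym (x∈⁅y⁆⇒x≡y b v≡b))) u≢v

  treewidth : ∀ {b} → b ∉ K → Treewidth graph ∣ K ∣
  treewidth {b} b∉K = decomposition , λ k D →
    ≤-pred (≤-trans (p⊂q⇒∣p∣<∣q∣ (p⊆p∪q ⁅ b ⁆ , b , q⊆p∪q K ⁅ b ⁆ (x∈⁅x⁆ b) , b∉K))
                    (clique-size D (extended-clique b)))

colourOf : Subset n → Fin n → Colour
colourOf p x = if lookup p x then blue else red

blueSet-colourOf : (p : Subset n) → blueSet (colourOf p) ≡ p
blueSet-colourOf p = trans (tabulate-cong (λ x → isBlue-if (lookup p x))) (tabulate∘lookup p)
  where
  isBlue-if : ∀ b → isBlue (if b then blue else red) ≡ b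
  isBlue-if true  = refl
  isBlue-if false = refl

cube : ℕ → ℕ
cube zero    = 1
cube (suc r) = cube r + cube r

cube≡2^ : ∀ r → cube r ≡ 2 ^ r
cube≡2^ zero    = refl
cube≡2^ (suc r) = begin
  cube r + cube r    ≡⟨ cong (λ c → c + c) (cube≡2^ r) ⟩
  2 ^ r + 2 ^ r      ≡⟨ cong (2 ^ r +_) (sym (+-identityʳ (2 ^ r))) ⟩
  2 * 2 ^ r          ∎
  where open ≡-Reasoning

origin : ∀ r → Fin (cube r)
origin zero    = zero
origin (suc r) = origin r ↑ˡ cube r

code : ∀ r → Fin (cube r) → Subset r
code zero    _ = []
code (suc r) u = [ (inside ∷_) ∘ code r , (outside ∷_) ∘ code r ] (splitAt (cube r) u)

code-injective : ∀ r {u x} → code r u ≡ code r x → u ≡ x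
code-injective zero {zero} {zero} _ = refl
code-injective (suc r) {u} {x} eq with splitAt (cube r) u in eu | splitAt (cube r) x in ex
... | inj₁ a | inj₁ b = trans (sym (splitAt⁻¹-↑ˡ eu))
                          (trans (cong (_↑ˡ cube r) (code-injective r (∷-injectiveʳ eq))) (splitAt⁻¹-↑ˡ ex))
... | inj₂ a | inj₂ b = trans (sym (splitAt⁻¹-↑ʳ eu))
                          (trans (cong (cube r ↑ʳ_) (code-injective r (∷-injectiveʳ eq))) (splitAt⁻¹-↑ʳ ex))
... | inj₁ _ | inj₂ _ = contradiction (∷-injectiveˡ eq) λ ()
... | inj₂ _ | inj₁ _ = contradiction (∷-injectiveˡ eq) λ ()

codeSet : ∀ r → Fin (cube r) → Subset (r + r)
codeSet r u = code r u ++ ∁ (code r u)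

codeSet-⊆⇒≡ : ∀ r {u x} → codeSet r u ⊆ codeSet r x → u ≡ x
codeSet-⊆⇒≡ r {u} {x} sub = code-injective r (++∁-⊆⇒≡ (code r u) (code r x) sub)

module Construction (N : ℕ) where

  r R s : ℕ
  r = suc N
  R = (r + r) + (r + r)
  s = cube r

  reds blues : Subset (R + s)
  reds  = ⊤ {R} ++ ⊥ {s}
  blues = ⊥ {R} ++ ⊤ {s}

  open CompleteSplit reds using (meets-K⇒connected; treewidth)

  G : Graph (R + s)
  G = CompleteSplit.graph reds

  colouring : Fin (R + s) → Colour
  colouring = colourOf blues

  redPart : Fin s → Fin s → Subset R
  redPart u v = codeSet r u ++ codeSet r v

  hyperedge : Fin s → Fin s → Subset (R + s)
  hyperedge u v = redPart u v ++ (⁅ u ⁆ ∪ ⁅ v ⁆)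

  H : Fin (s * s) → Subset (R + s)
  H i = uncurry hyperedge (remQuot s i)

  N≤R : N ≤ R
  N≤R = ≤-trans (n≤1+n N) (≤-trans (m≤m+n r r) (m≤m+n (r + r) (r + r)))

  red∈reds : ∀ ρ → ρ ↑ˡ s ∈ reds
  red∈reds ρ = ∈-++⁺ˡ {p = ⊤ {R}} ∈⊤

  hyperedge-connected : ∀ u v → Nonempty (hyperedge u v) × Connected (adj G) (hyperedge u v)
  hyperedge-connected u v with ++∁-nonempty (code r u)
  ... | ρ , ρ∈ = (_ , ρ∈H) , meets-K⇒connected (red∈reds (ρ ↑ˡ (r + r))) ρ∈H
    where
    ρ∈H : (ρ ↑ˡ (r + r)) ↑ˡ s ∈ hyperedge u v
    ρ∈H = ∈-++⁺ˡ (∈-++⁺ˡ ρ∈)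

  -- Either the red parts already differ, or the two hyperedges coincide.
  difference-connected : ∀ u v x y → Connected (adj G) (hyperedge u v ─ hyperedge x y)
  difference-connected u v x y with ⊆-or-escapes (redPart u v) (redPart x y)
  ... | inj₂ (ρ , ρ∈ , ρ∉) =
    meets-K⇒connected (red∈reds ρ) (x∈p∧x∉q⇒x∈p─q (∈-++⁺ˡ ρ∈) (ρ∉ ∘ ∈-++⁻ˡ (redPart x y)))
  ... | inj₁ sub with ++-⊆⁻ (codeSet r u) (codeSet r x) sub
  ...   | u⊆x , v⊆y with codeSet-⊆⇒≡ r u⊆x | codeSet-⊆⇒≡ r v⊆y
  ...   | refl | refl = λ a _ a∈ _ →
    contradiction (p─q⊆p (hyperedge u v) _ a∈) (x∈p─q⇒x∉q (hyperedge u v) (hyperedge u v) a∈)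

  nonPiercing : NonPiercing G H
  nonPiercing = (λ i → hyperedge-connected _ _) , (λ i j → difference-connected _ _ _ _)

  blue-members : ∀ {u v w} → w ∈ hyperedge u v ∩ blues → w ≡ R ↑ʳ u ⊎ w ≡ R ↑ʳ v
  blue-members {u} {v} {w} w∈ with x∈p∩q⁻ (hyperedge u v) blues w∈ | splitView R w
  ... | _ , w∈B | left ρ = contradiction (∈-++⁻ˡ (⊥ {R}) w∈B) ∉⊥
  ... | w∈H , _ | right w′ with x∈p∪q⁻ ⁅ u ⁆ ⁅ v ⁆ (∈-++⁻ʳ (redPart u v) w∈H)
  ...   | inj₁ w′∈u = inj₁ (cong (R ↑ʳ_) (x∈⁅y⁆⇒x≡y u w′∈u))
  ...   | inj₂ w′∈v = inj₂ (cong (R ↑ʳ_) (x∈⁅y⁆⇒x≡y v w′∈v))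

  support-clique : ∀ Q → PrimalSupport G colouring H Q → IsClique Q blues
  support-clique Q (_ , connected) {u} {v} u∈B v∈B u≢v with splitView R u | splitView R v
  ... | left ρ   | _        = contradiction (∈-++⁻ˡ (⊥ {R}) u∈B) ∉⊥
  ... | right _  | left ρ   = contradiction (∈-++⁻ˡ (⊥ {R}) v∈B) ∉⊥
  ... | right u′ | right v′ = walk-within-pair⇒adj Q u≢v blue-members
        (pair-connected _ _ (x∈p∩q⁺ (∈-++⁺ʳ (redPart u′ v′) (p⊆p∪q ⁅ v′ ⁆ (x∈⁅x⁆ u′)) , u∈B))
                            (x∈p∩q⁺ (∈-++⁺ʳ (redPart u′ v′) (q⊆p∪q ⁅ u′ ⁆ ⁅ v′ ⁆ (x∈⁅x⁆ v′)) , v∈B)))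
    where
    pair-connected : Connected (adj Q) (hyperedge u′ v′ ∩ blues)
    pair-connected = subst₂ (λ X Y → Connected (adj Q) (X ∩ Y))
                            (cong (uncurry hyperedge) (remQuot-combine u′ v′)) (blueSet-colourOf blues)
                            (connected (combine u′ v′))

  G-treewidth : Treewidth G R
  G-treewidth = subst (Treewidth G) ∣reds∣≡R (treewidth blue∉reds)
    where
    ∣reds∣≡R : ∣ reds ∣ ≡ R
    ∣reds∣≡R = trans (∣p++q∣≡∣p∣+∣q∣ (⊤ {R}) (⊥ {s})) (trans (cong₂ _+_ (∣⊤∣≡n R) (∣⊥∣≡0 s)) (+-identityʳ R))
    blue∉reds : R ↑ʳ origin r ∉ reds
    blue∉reds b∈ = ∉⊥ (∈-++⁻ʳ (⊤ {R}) b∈)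

  support-treewidth : ∀ Q → PrimalSupport G colouring H Q → ∀ k → TreeDecomposition Q k → 2 ^ r ≤ suc k
  support-treewidth Q Q-support k D =
    subst (_≤ suc k) ∣blues∣≡2^r (clique-size D (support-clique Q Q-support))
    where
    ∣blues∣≡2^r : ∣ blues ∣ ≡ 2 ^ r
    ∣blues∣≡2^r = trans (∣p++q∣≡∣p∣+∣q∣ (⊥ {R}) (⊤ {s})) (trans (cong₂ _+_ (∣⊥∣≡0 R) (∣⊤∣≡n s)) (cube≡2^ r))

-- With t = 4r, the bound 2^r ≤ k + 1 already gives 2^(t/4) ≤ 2k, far more than 2^(t/(8(1+ε))).
power-bound : ∀ N p q k → 2 ^ suc N ≤ suc k →
              1 ^ (8 * (suc q + suc p)) * 2 ^ (((suc N + suc N) + (suc N + suc N)) * suc q)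
                ≤ (2 * k) ^ (8 * (suc q + suc p))
power-bound N p q k 2^r≤1+k = begin
  1 ^ E * 2 ^ (R * suc q)  ≡⟨ cong (_* 2 ^ (R * suc q)) (^-zeroˡ E) ⟩
  1 * 2 ^ (R * suc q)      ≡⟨ *-identityˡ _ ⟩
  2 ^ (R * suc q)          ≤⟨ ^-monoʳ-≤ 2 exponent-bound ⟩
  2 ^ (r * E)              ≡⟨ ^-*-assoc 2 r E ⟨
  (2 ^ r) ^ E              ≤⟨ ^-monoˡ-≤ E 2^r≤2k ⟩
  (2 * k) ^ E              ∎
  where
  open ≤-Reasoning
  r R E : ℕ
  r = suc N
  R = (r + r) + (r + r)
  E = 8 * (suc q + suc p)
  1≤k : 1 ≤ k
  1≤k = ≤-pred (≤-trans (^-monoʳ-≤ 2 {1} {r} (s≤s z≤n)) 2^r≤1+k)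
  2^r≤2k : 2 ^ r ≤ 2 * k
  2^r≤2k = begin
    2 ^ r   ≤⟨ 2^r≤1+k ⟩
    suc k   ≡⟨ +-comm 1 k ⟩
    k + 1   ≤⟨ +-monoʳ-≤ k 1≤k ⟩
    k + k   ≡⟨ cong (k +_) (+-identityʳ k) ⟨
    2 * k   ∎
  regroup : ∀ r x → (((r + r) + (r + r)) + ((r + r) + (r + r))) * x ≡ r * (8 * x)
  regroup = solve-∀
  exponent-bound : R * suc q ≤ r * E
  exponent-bound = begin
    R * suc q                ≤⟨ *-monoʳ-≤ R (m≤m+n (suc q) (suc p)) ⟩
    R * (suc q + suc p)      ≤⟨ *-monoˡ-≤ (suc q + suc p) (m≤m+n R R) ⟩
    (R + R) * (suc q + suc p) ≡⟨ regroup r (suc q + suc p) ⟩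
    r * E                    ∎

theorem9 : (p q : ℕ) → ∃[ a ] ∃[ b ] ((N : ℕ) →
             ∃[ n ] Σ (Graph n) λ G → ∃[ t ] (N ≤ t × Treewidth G t ×
               Σ (Fin n → Colour) λ c → ∃[ h ] Σ (Fin h → Subset n) λ H →
                 NonPiercing G H ×
                 ((Q : Graph n) → PrimalSupport G c H Q → (k : ℕ) → TreeDecomposition Q k →
                   (suc a) ^ (8 * (suc q + suc p)) * 2 ^ (t * suc q)
                     ≤ (suc b * k) ^ (8 * (suc q + suc p)))))
theorem9 p q = 0 , 1 , λ N →
  let open Construction N in
  R + s , G , R , N≤R , G-treewidth , colouring , s * s , H , nonPiercing ,
  λ Q Q-support k D → power-bound N p q k (support-treewidth Q Q-support k D)
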